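{- For any algebra $(A,\to,1)$ of type $(2,0)$, the conjunction of (Re), (Ex), (An) holds if and only if the conjunction of (Re), (M), (Ex), (An) holds.
   Context: Properties, for all $x,y,z\in A$: (Re) $x\to x=1$; (M) $1\to x=x$; (Ex) $x\to(y\to z)=y\to(x\to z)$; (An) $x\to y=1=y\to x\Rightarrow x=y$. -}

module Defs where

open import Level using (Level; _⊔_)
open import Data.Product using (_×_)
open import Relation.Binary.PropositionalEquality using (_≡_)

record Algebra20 (a : Level) : Set (Level.suc a) where
  field
    Carrier : Set a
    _⇒_     : Carrier → Carrier → Carrier
    one     : Carrier

module _ {a : Level} (𝔸 : Algebra20 a) where
  open Algebra20 𝔸

  Re : Set a
  Re = ∀ x → (x ⇒ x) ≡ one

  M : Set a
  M = ∀ x → (one ⇒ x) ≡ x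

  Ex : Set a
  Ex = ∀ x y z → (x ⇒ (y ⇒ z)) ≡ (y ⇒ (x ⇒ z))

  An : Set a
  An = ∀ x y → (x ⇒ y) ≡ one → (y ⇒ x) ≡ one → x ≡ y

module Submission where

-- Exchange moves any premise to the front: x → (1 → x) = 1 → (x → x) = 1, and
-- 1 → ((1 → x) → x) = (1 → x) → (1 → x) = 1. The same trick turns 1 → w = 1 into
-- w → 1 = 1, so (An) gives (1 → x) → x = 1, and then (An) once more gives 1 → x = x.

open import Defs
open import Level using (Level)
open import Data.Product using (_×_; _,_)
open import Function.Bundles using (_⇔_; mk⇔)
open import Relation.Binary.PropositionalEquality
open ≡-Reasoning

module _ {a : Level} (𝔸 : Algebra20 a) where
  open Algebra20 𝔸

  module _ (re : Re 𝔸) (ex : Ex 𝔸) where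

    x⇒[y⇒x]≡y⇒one : ∀ x y → (x ⇒ (y ⇒ x)) ≡ (y ⇒ one)
    x⇒[y⇒x]≡y⇒one x y = begin
      x ⇒ (y ⇒ x)  ≡⟨ ex x y x ⟩
      y ⇒ (x ⇒ x)  ≡⟨ cong (y ⇒_) (re x) ⟩
      y ⇒ one      ∎

    x⇒[one⇒x]≡one : ∀ x → (x ⇒ (one ⇒ x)) ≡ one
    x⇒[one⇒x]≡one x = trans (x⇒[y⇒x]≡y⇒one x one) (re one)

    x⇒one≡one-if-one⇒x≡one : ∀ {x} → (one ⇒ x) ≡ one → (x ⇒ one) ≡ one
    x⇒one≡one-if-one⇒x≡one {x} one⇒x≡one = begin
      x ⇒ one        ≡⟨ cong (x ⇒_) (sym one⇒x≡one) ⟩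
      x ⇒ (one ⇒ x)  ≡⟨ x⇒[one⇒x]≡one x ⟩
      one            ∎

    one⇒[[one⇒x]⇒x]≡one : ∀ x → (one ⇒ ((one ⇒ x) ⇒ x)) ≡ one
    one⇒[[one⇒x]⇒x]≡one x = trans (ex one (one ⇒ x) x) (re (one ⇒ x))

    module _ (an : An 𝔸) where

      [one⇒x]⇒x≡one : ∀ x → ((one ⇒ x) ⇒ x) ≡ one
      [one⇒x]⇒x≡one x = an _ one (x⇒one≡one-if-one⇒x≡one lhs≡one) lhs≡one
        where
        lhs≡one : (one ⇒ ((one ⇒ x) ⇒ x)) ≡ one
        lhs≡one = one⇒[[one⇒x]⇒x]≡one x

      Re∧Ex∧An⇒M : M 𝔸
      Re∧Ex∧An⇒M x = an (one ⇒ x) x ([one⇒x]⇒x≡one x) (x⇒[one⇒x]≡one x)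

corollary4p2 : ∀ {a : Level} (𝔸 : Algebra20 a) →
    (Re 𝔸 × Ex 𝔸 × An 𝔸) ⇔ (Re 𝔸 × M 𝔸 × Ex 𝔸 × An 𝔸)
corollary4p2 𝔸 = mk⇔ (λ { (re , ex , an) → re , Re∧Ex∧An⇒M 𝔸 re ex an , ex , an })
                     (λ { (re , _ , ex , an) → re , ex , an })
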